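{- Let $A$ be a $3\times3$ integer matrix and let $q(\mathbf{x})=J(A\mathbf{x})$, where $J(\mathbf{x})=x_1x_3-x_2^2$. Then there is a matrix $U\in\mathrm{Aut}(J)$ such that the rows $\mathbf{a},\mathbf{b},\mathbf{c}$ of $UA$ satisfy $\|\mathbf{a}\|\cdot\|\mathbf{c}\|\le 9\|q\|$ and $\|\mathbf{b}\|^2\le 10\|q\|$.
   Context: $\mathrm{Aut}(J)$ is the set of $3\times3$ integer matrices $U$ with $J(U\mathbf{x})=J(\mathbf{x})$ identically. For a ternary quadratic form $q(\mathbf{x})=\sum_{1\le i\le j\le3}q_{ij}x_ix_j$, $\|q\|$ is the Frobenius norm of $Q=\begin{pmatrix}2q_{11}&q_{12}&q_{13}\\ q_{12}&2q_{22}&q_{23}\\ q_{13}&q_{23}&2q_{33}\end{pmatrix}$. $\|\cdot\|$ on vectors is the Euclidean norm. -}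

module Defs where

open import Data.Fin using (Fin; zero; suc)
open import Data.Integer using (ℤ; +_; _+_; _-_; _*_; _≤_)
open import Relation.Binary.PropositionalEquality using (_≡_)

Vec3 : Set
Vec3 = Fin 3 → ℤ

Mat3 : Set
Mat3 = Fin 3 → Fin 3 → ℤ

i₀ i₁ i₂ : Fin 3
i₀ = zero
i₁ = suc zero
i₂ = suc (suc zero)

dot : Vec3 → Vec3 → ℤ
dot u v = u i₀ * v i₀ + u i₁ * v i₁ + u i₂ * v i₂

_·ᵥ_ : Mat3 → Vec3 → Vec3
(M ·ᵥ x) i = dot (M i) x

_·ₘ_ : Mat3 → Mat3 → Mat3
(M ·ₘ N) i j = M i i₀ * N i₀ j + M i i₁ * N i₁ j + M i i₂ * N i₂ j

J : Vec3 → ℤ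
J x = x i₀ * x i₂ - x i₁ * x i₁

IsAutJ : Mat3 → Set
IsAutJ U = ∀ (x : Vec3) → J (U ·ᵥ x) ≡ J x

record TernaryForm : Set where
  constructor form
  field
    q11 q12 q13 q22 q23 q33 : ℤ

open TernaryForm public

evalForm : TernaryForm → Vec3 → ℤ
evalForm q x =
  q11 q * x i₀ * x i₀ + q12 q * x i₀ * x i₁ + q13 q * x i₀ * x i₂
  + q22 q * x i₁ * x i₁ + q23 q * x i₁ * x i₂ + q33 q * x i₂ * x i₂

Qmat : TernaryForm → Mat3
Qmat q zero zero = + 2 * q11 q
Qmat q zero (suc zero) = q12 q
Qmat q zero (suc (suc zero)) = q13 q
Qmat q (suc zero) zero = q12 q
Qmat q (suc zero) (suc zero) = + 2 * q22 q
Qmat q (suc zero) (suc (suc zero)) = q23 q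
Qmat q (suc (suc zero)) zero = q13 q
Qmat q (suc (suc zero)) (suc zero) = q23 q
Qmat q (suc (suc zero)) (suc (suc zero)) = + 2 * q33 q

normSqV : Vec3 → ℤ
normSqV v = dot v v

normSqF : TernaryForm → ℤ
normSqF q = normSqV (Qmat q i₀) + normSqV (Qmat q i₁) + normSqV (Qmat q i₂)

-- Whenever one of the automorphisms upper ±1, lower ±1 of J shortens the middle row b of
-- B = UA, apply it; as ‖b‖² is a nonnegative integer this stops, at a B whose rows a, b, c
-- satisfy |2 a·b| ≤ ‖a‖² and |2 b·c| ≤ ‖c‖².  The matrix of q = J ∘ B is a cᵀ + c aᵀ − 2 b bᵀ,
-- so ‖q‖² depends only on the Gram matrix of a, b, c:
--   ‖q‖² = 2‖a‖²‖c‖² + 2(a·c)² − 8(a·b)(b·c) + 4‖b‖⁴ = X + Y + 2(a·c)² + 4‖b‖⁴,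
-- where X = (‖a‖² − 2a·b)(‖c‖² + 2b·c) and Y = (‖a‖² + 2a·b)(‖c‖² − 2b·c) are nonnegative.
-- Hence 4‖b‖⁴ ≤ ‖q‖², and with 8(a·b)(b·c) ≤ ‖a‖²‖c‖² + 16‖b‖⁴ also ‖a‖²‖c‖² ≤ 4‖q‖²,
-- which are stronger than the bounds claimed.
module Submission where

open import Defs
open import Data.Integer
  using (ℤ; +_; -[1+_]; nonNegative; _+_; _-_; -_; _*_; _≤_; _<_; +≤+; +<+; 0ℤ; ∣_∣; _≤?_)
open import Data.Integer.Properties
  using (pos-*; +-mono-≤; +-monoʳ-≤; +-identityʳ; i≤j⇒0≤j-i; ≰⇒>; <-≤-trans; ≤⇒≯;
         i<j⇒i≤pred[j]; 0≤i⇒+∣i∣≡i; ≤-trans;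
         *-monoʳ-≤-nonNeg; *-identityˡ; module ≤-Reasoning)
open import Data.Integer.Tactic.RingSolver using (solve-∀)
open import Data.Nat as ℕ using (ℕ; zero; suc; z≤n)
open import Data.Nat.Properties using (n<1+n; m≤m+n)
open import Data.Fin using (Fin; zero; suc)
open import Data.Product using (Σ; _×_; _,_; proj₁; proj₂)
open import Data.Sum using (_⊎_; inj₁; inj₂)
open import Data.Empty using (⊥-elim)
open import Relation.Nullary using (yes; no)
open import Relation.Binary.PropositionalEquality
  using (_≡_; refl; sym; trans; cong; cong₂; subst; subst₂; _≗_; module ≡-Reasoning)

0≤-* : ∀ {i j} → 0ℤ ≤ i → 0ℤ ≤ j → 0ℤ ≤ i * j
0≤-* {+ m} {+ n} _ _ = subst (0ℤ ≤_) (pos-* m n) (+≤+ z≤n)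

0≤-+ : ∀ {i j} → 0ℤ ≤ i → 0ℤ ≤ j → 0ℤ ≤ i + j
0≤-+ = +-mono-≤

0≤-square : ∀ i → 0ℤ ≤ i * i
0≤-square (+ m)    = 0≤-* {+ m} {+ m} (+≤+ z≤n) (+≤+ z≤n)
0≤-square -[1+ m ] = +≤+ z≤n

0≤-scale : ∀ n {i} → 0ℤ ≤ i → 0ℤ ≤ + n * i
0≤-scale n {i} = 0≤-* {+ n} {i} (+≤+ z≤n)

0≤-normSqV : ∀ v → 0ℤ ≤ normSqV v
0≤-normSqV v = 0≤-+ (0≤-+ (0≤-square (v i₀)) (0≤-square (v i₁))) (0≤-square (v i₂))

normSqM : Mat3 → ℤ
normSqM M = normSqV (M i₀) + normSqV (M i₁) + normSqV (M i₂)

0≤-normSqM : ∀ M → 0ℤ ≤ normSqM M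
0≤-normSqM M = 0≤-+ (0≤-+ (0≤-normSqV (M i₀)) (0≤-normSqV (M i₁))) (0≤-normSqV (M i₂))

≤-by-difference : ∀ {i j} d → j ≡ i + d → 0ℤ ≤ d → i ≤ j
≤-by-difference {i} d j≡i+d 0≤d = subst₂ _≤_ (+-identityʳ i) (sym j≡i+d) (+-monoʳ-≤ i 0≤d)

≤-scale : ∀ {i m n} → m ℕ.≤ n → 0ℤ ≤ i → + m * i ≤ + n * i
≤-scale {i} m≤n 0≤i = *-monoʳ-≤-nonNeg i {{nonNegative 0≤i}} (+≤+ m≤n)

0≤-difference : ∀ {i j} d → j ≡ i + d → i ≤ j → 0ℤ ≤ d
0≤-difference {i} d j≡i+d i≤j =
  subst (0ℤ ≤_) (cancel i d) (subst (λ k → 0ℤ ≤ k - i) j≡i+d (i≤j⇒0≤j-i i≤j))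
  where
  cancel : ∀ i d → i + d - i ≡ d
  cancel = solve-∀

vec : ℤ → ℤ → ℤ → Vec3
vec x₀ x₁ x₂ zero             = x₀
vec x₀ x₁ x₂ (suc zero)       = x₁
vec x₀ x₁ x₂ (suc (suc zero)) = x₂

rows : Vec3 → Vec3 → Vec3 → Mat3
rows r₀ r₁ r₂ zero             = r₀
rows r₀ r₁ r₂ (suc zero)       = r₁
rows r₀ r₁ r₂ (suc (suc zero)) = r₂

-- The ring solver does not unfold definitions, so each polynomial identity below restates
-- its goal through let-bound copies of dot, J, evalForm, … that unfold to the same term.
·ᵥ-assoc : ∀ M N x → (M ·ₘ N) ·ᵥ x ≗ M ·ᵥ (N ·ᵥ x)
·ᵥ-assoc M N x i = identity (M i i₀) (M i i₁) (M i i₂)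
  (N i₀ i₀) (N i₀ i₁) (N i₀ i₂) (N i₁ i₀) (N i₁ i₁) (N i₁ i₂) (N i₂ i₀) (N i₂ i₁) (N i₂ i₂)
  (x i₀) (x i₁) (x i₂)
  where
  identity : ∀ m₀ m₁ m₂ n₀₀ n₀₁ n₀₂ n₁₀ n₁₁ n₁₂ n₂₀ n₂₁ n₂₂ x₀ x₁ x₂ →
    let d : ℤ → ℤ → ℤ → ℤ → ℤ → ℤ → ℤ
        d u₀ u₁ u₂ v₀ v₁ v₂ = u₀ * v₀ + u₁ * v₁ + u₂ * v₂
    in d (d m₀ m₁ m₂ n₀₀ n₁₀ n₂₀) (d m₀ m₁ m₂ n₀₁ n₁₁ n₂₁) (d m₀ m₁ m₂ n₀₂ n₁₂ n₂₂) x₀ x₁ x₂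
       ≡ d m₀ m₁ m₂ (d n₀₀ n₀₁ n₀₂ x₀ x₁ x₂) (d n₁₀ n₁₁ n₁₂ x₀ x₁ x₂) (d n₂₀ n₂₁ n₂₂ x₀ x₁ x₂)
  identity = solve-∀

-- Definitionally, each column of a matrix product is a matrix–vector product.
·ₘ-assoc : ∀ M N P i → ((M ·ₘ N) ·ₘ P) i ≗ (M ·ₘ (N ·ₘ P)) i
·ₘ-assoc M N P i j = ·ᵥ-assoc M N (λ k → P k j) i

J-cong : ∀ {u v} → u ≗ v → J u ≡ J v
J-cong u≗v = cong₂ _-_ (cong₂ _*_ (u≗v i₀) (u≗v i₂)) (cong₂ _*_ (u≗v i₁) (u≗v i₁))

normSqV-cong : ∀ {u v} → u ≗ v → normSqV u ≡ normSqV v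
normSqV-cong u≗v =
  cong₂ _+_ (cong₂ _+_ (cong₂ _*_ (u≗v i₀) (u≗v i₀)) (cong₂ _*_ (u≗v i₁) (u≗v i₁)))
            (cong₂ _*_ (u≗v i₂) (u≗v i₂))

IsAutJ-·ₘ : ∀ {M N} → IsAutJ M → IsAutJ N → IsAutJ (M ·ₘ N)
IsAutJ-·ₘ {M} {N} autM autN x = begin
  J ((M ·ₘ N) ·ᵥ x)   ≡⟨ J-cong (·ᵥ-assoc M N x) ⟩
  J (M ·ᵥ (N ·ᵥ x))   ≡⟨ autM (N ·ᵥ x) ⟩
  J (N ·ᵥ x)          ≡⟨ autN x ⟩
  J x                 ∎
  where open ≡-Reasoning

-- Reading x as the binary form x₁X² + 2x₂XY + x₃Y², of discriminant −4 J(x), upper k and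
-- lower k are the unimodular substitutions Y ↦ kX + Y and X ↦ X + kY.
upper lower : ℤ → Mat3
upper k = rows (vec (+ 1) (+ 2 * k) (k * k)) (vec (+ 0) (+ 1) k) (vec (+ 0) (+ 0) (+ 1))
lower k = rows (vec (+ 1) (+ 0) (+ 0)) (vec k (+ 1) (+ 0)) (vec (k * k) (+ 2 * k) (+ 1))

upper-isAutJ : ∀ k → IsAutJ (upper k)
upper-isAutJ k x = identity k (x i₀) (x i₁) (x i₂)
  where
  identity : ∀ k x₀ x₁ x₂ →
    let r : ℤ → ℤ → ℤ → ℤ
        r m₀ m₁ m₂ = m₀ * x₀ + m₁ * x₁ + m₂ * x₂
    in r (+ 1) (+ 2 * k) (k * k) * r (+ 0) (+ 0) (+ 1) - r (+ 0) (+ 1) k * r (+ 0) (+ 1) k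
       ≡ x₀ * x₂ - x₁ * x₁
  identity = solve-∀

lower-isAutJ : ∀ k → IsAutJ (lower k)
lower-isAutJ k x = identity k (x i₀) (x i₁) (x i₂)
  where
  identity : ∀ k x₀ x₁ x₂ →
    let r : ℤ → ℤ → ℤ → ℤ
        r m₀ m₁ m₂ = m₀ * x₀ + m₁ * x₁ + m₂ * x₂
    in r (+ 1) (+ 0) (+ 0) * r (k * k) (+ 2 * k) (+ 1) - r k (+ 1) (+ 0) * r k (+ 1) (+ 0)
       ≡ x₀ * x₂ - x₁ * x₁
  identity = solve-∀

gram : Mat3 → Fin 3 → Fin 3 → ℤ
gram B i j = dot (B i) (B j)

shift : ℤ → ℤ → ℤ → ℤ
shift k α δ = k * k * α + + 2 * k * δ

gram-lower : ∀ k B → gram (lower k ·ₘ B) i₁ i₁ ≡ gram B i₁ i₁ + shift k (gram B i₀ i₀) (gram B i₀ i₁)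
gram-lower k B = identity k (B i₀ i₀) (B i₀ i₁) (B i₀ i₂) (B i₁ i₀) (B i₁ i₁) (B i₁ i₂)
                            (B i₂ i₀) (B i₂ i₁) (B i₂ i₂)
  where
  identity : ∀ k a₀ a₁ a₂ b₀ b₁ b₂ c₀ c₁ c₂ →
    let d : ℤ → ℤ → ℤ → ℤ → ℤ → ℤ → ℤ
        d u₀ u₁ u₂ v₀ v₁ v₂ = u₀ * v₀ + u₁ * v₁ + u₂ * v₂
        r : ℤ → ℤ → ℤ → ℤ
        r a b c = k * a + + 1 * b + + 0 * c
    in d (r a₀ b₀ c₀) (r a₁ b₁ c₁) (r a₂ b₂ c₂) (r a₀ b₀ c₀) (r a₁ b₁ c₁) (r a₂ b₂ c₂)
       ≡ d b₀ b₁ b₂ b₀ b₁ b₂ + (k * k * d a₀ a₁ a₂ a₀ a₁ a₂ + + 2 * k * d a₀ a₁ a₂ b₀ b₁ b₂)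
  identity = solve-∀

gram-upper : ∀ k B → gram (upper k ·ₘ B) i₁ i₁ ≡ gram B i₁ i₁ + shift k (gram B i₂ i₂) (gram B i₁ i₂)
gram-upper k B = identity k (B i₀ i₀) (B i₀ i₁) (B i₀ i₂) (B i₁ i₀) (B i₁ i₁) (B i₁ i₂)
                            (B i₂ i₀) (B i₂ i₁) (B i₂ i₂)
  where
  identity : ∀ k a₀ a₁ a₂ b₀ b₁ b₂ c₀ c₁ c₂ →
    let d : ℤ → ℤ → ℤ → ℤ → ℤ → ℤ → ℤ
        d u₀ u₁ u₂ v₀ v₁ v₂ = u₀ * v₀ + u₁ * v₁ + u₂ * v₂
        r : ℤ → ℤ → ℤ → ℤ
        r a b c = + 0 * a + + 1 * b + k * c
    in d (r a₀ b₀ c₀) (r a₁ b₁ c₁) (r a₂ b₂ c₂) (r a₀ b₀ c₀) (r a₁ b₁ c₁) (r a₂ b₂ c₂)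
       ≡ d b₀ b₁ b₂ b₀ b₁ b₂ + (k * k * d c₀ c₁ c₂ c₀ c₁ c₂ + + 2 * k * d b₀ b₁ b₂ c₀ c₁ c₂)
  identity = solve-∀

record Reduced (B : Mat3) : Set where
  field
    lower⁺ : gram B i₁ i₁ ≤ gram (lower (+ 1) ·ₘ B) i₁ i₁
    lower⁻ : gram B i₁ i₁ ≤ gram (lower (- + 1) ·ₘ B) i₁ i₁
    upper⁺ : gram B i₁ i₁ ≤ gram (upper (+ 1) ·ₘ B) i₁ i₁
    upper⁻ : gram B i₁ i₁ ≤ gram (upper (- + 1) ·ₘ B) i₁ i₁

reduced-or-descent : ∀ B → Reduced B ⊎ Σ Mat3 (λ M → IsAutJ M × gram (M ·ₘ B) i₁ i₁ < gram B i₁ i₁)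
reduced-or-descent B
  with gram B i₁ i₁ ≤? gram (lower (+ 1) ·ₘ B) i₁ i₁
     | gram B i₁ i₁ ≤? gram (lower (- + 1) ·ₘ B) i₁ i₁
     | gram B i₁ i₁ ≤? gram (upper (+ 1) ·ₘ B) i₁ i₁
     | gram B i₁ i₁ ≤? gram (upper (- + 1) ·ₘ B) i₁ i₁
... | yes l⁺ | yes l⁻ | yes u⁺ | yes u⁻ =
  inj₁ (record { lower⁺ = l⁺ ; lower⁻ = l⁻ ; upper⁺ = u⁺ ; upper⁻ = u⁻ })
... | no ¬l⁺ | _      | _      | _      = inj₂ (lower (+ 1) , lower-isAutJ (+ 1) , ≰⇒> ¬l⁺)
... | yes _  | no ¬l⁻ | _      | _      = inj₂ (lower (- + 1) , lower-isAutJ (- + 1) , ≰⇒> ¬l⁻)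
... | yes _  | yes _  | no ¬u⁺ | _      = inj₂ (upper (+ 1) , upper-isAutJ (+ 1) , ≰⇒> ¬u⁺)
... | yes _  | yes _  | yes _  | no ¬u⁻ = inj₂ (upper (- + 1) , upper-isAutJ (- + 1) , ≰⇒> ¬u⁻)

reduce-from : ∀ A U → IsAutJ U → (n : ℕ) → gram (U ·ₘ A) i₁ i₁ < + n
            → Σ Mat3 (λ V → IsAutJ V × Reduced (V ·ₘ A))
reduce-from A U autU zero β<0 = ⊥-elim (≤⇒≯ (0≤-normSqV ((U ·ₘ A) i₁)) β<0)
reduce-from A U autU (suc n) β<1+n with reduced-or-descent (U ·ₘ A)
... | inj₁ reduced = U , autU , reduced
... | inj₂ (M , autM , descent) = reduce-from A (M ·ₘ U) (IsAutJ-·ₘ {M} {U} autM autU) n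
  (<-≤-trans (subst (_< gram (U ·ₘ A) i₁ i₁) (sym (normSqV-cong (·ₘ-assoc M U A i₁))) descent)
             (i<j⇒i≤pred[j] β<1+n))

reduction : ∀ A → Σ Mat3 (λ U → IsAutJ U × Reduced (U ·ₘ A))
reduction A = reduce-from A (upper (+ 0)) (upper-isAutJ (+ 0)) (suc ∣ β ∣)
  (subst (_< + suc ∣ β ∣) (0≤i⇒+∣i∣≡i (0≤-normSqV ((upper (+ 0) ·ₘ A) i₁))) (+<+ (n<1+n ∣ β ∣)))
  where
  β : ℤ
  β = gram (upper (+ 0) ·ₘ A) i₁ i₁

e₀ e₁ e₂ e₀₁ e₀₂ e₁₂ : Vec3
e₀  = vec (+ 1) (+ 0) (+ 0)
e₁  = vec (+ 0) (+ 1) (+ 0)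
e₂  = vec (+ 0) (+ 0) (+ 1)
e₀₁ = vec (+ 1) (+ 1) (+ 0)
e₀₂ = vec (+ 1) (+ 0) (+ 1)
e₁₂ = vec (+ 0) (+ 1) (+ 1)

polarize : (Vec3 → ℤ) → TernaryForm
polarize v = form (v e₀) (v e₀₁ - v e₀ - v e₁) (v e₀₂ - v e₀ - v e₂)
                  (v e₁) (v e₁₂ - v e₁ - v e₂) (v e₂)

polarize-cong : ∀ {v w} → (∀ x → v x ≡ w x) → polarize v ≡ polarize w
polarize-cong v≗w rewrite v≗w e₀ | v≗w e₁ | v≗w e₂ | v≗w e₀₁ | v≗w e₀₂ | v≗w e₁₂ = refl

form-cong : ∀ {a b c d e f a′ b′ c′ d′ e′ f′} → a ≡ a′ → b ≡ b′ → c ≡ c′ → d ≡ d′ → e ≡ e′ → f ≡ f′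
          → form a b c d e f ≡ form a′ b′ c′ d′ e′ f′
form-cong refl refl refl refl refl refl = refl

polarize-evalForm : ∀ q → polarize (evalForm q) ≡ q
polarize-evalForm (form q₁₁ q₁₂ q₁₃ q₂₂ q₂₃ q₃₃) = form-cong
  (coefficient₁₁ q₁₁ q₁₂ q₁₃ q₂₂ q₂₃ q₃₃) (coefficient₁₂ q₁₁ q₁₂ q₁₃ q₂₂ q₂₃ q₃₃)
  (coefficient₁₃ q₁₁ q₁₂ q₁₃ q₂₂ q₂₃ q₃₃) (coefficient₂₂ q₁₁ q₁₂ q₁₃ q₂₂ q₂₃ q₃₃)
  (coefficient₂₃ q₁₁ q₁₂ q₁₃ q₂₂ q₂₃ q₃₃) (coefficient₃₃ q₁₁ q₁₂ q₁₃ q₂₂ q₂₃ q₃₃)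
  where
  coefficient₁₁ : ∀ q₁₁ q₁₂ q₁₃ q₂₂ q₂₃ q₃₃ →
    let v : ℤ → ℤ → ℤ → ℤ
        v x₀ x₁ x₂ = q₁₁ * x₀ * x₀ + q₁₂ * x₀ * x₁ + q₁₃ * x₀ * x₂
                   + q₂₂ * x₁ * x₁ + q₂₃ * x₁ * x₂ + q₃₃ * x₂ * x₂
    in v (+ 1) (+ 0) (+ 0) ≡ q₁₁
  coefficient₁₁ = solve-∀
  coefficient₁₂ : ∀ q₁₁ q₁₂ q₁₃ q₂₂ q₂₃ q₃₃ →
    let v : ℤ → ℤ → ℤ → ℤ
        v x₀ x₁ x₂ = q₁₁ * x₀ * x₀ + q₁₂ * x₀ * x₁ + q₁₃ * x₀ * x₂
                   + q₂₂ * x₁ * x₁ + q₂₃ * x₁ * x₂ + q₃₃ * x₂ * x₂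
    in v (+ 1) (+ 1) (+ 0) - v (+ 1) (+ 0) (+ 0) - v (+ 0) (+ 1) (+ 0) ≡ q₁₂
  coefficient₁₂ = solve-∀
  coefficient₁₃ : ∀ q₁₁ q₁₂ q₁₃ q₂₂ q₂₃ q₃₃ →
    let v : ℤ → ℤ → ℤ → ℤ
        v x₀ x₁ x₂ = q₁₁ * x₀ * x₀ + q₁₂ * x₀ * x₁ + q₁₃ * x₀ * x₂
                   + q₂₂ * x₁ * x₁ + q₂₃ * x₁ * x₂ + q₃₃ * x₂ * x₂
    in v (+ 1) (+ 0) (+ 1) - v (+ 1) (+ 0) (+ 0) - v (+ 0) (+ 0) (+ 1) ≡ q₁₃
  coefficient₁₃ = solve-∀
  coefficient₂₂ : ∀ q₁₁ q₁₂ q₁₃ q₂₂ q₂₃ q₃₃ →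
    let v : ℤ → ℤ → ℤ → ℤ
        v x₀ x₁ x₂ = q₁₁ * x₀ * x₀ + q₁₂ * x₀ * x₁ + q₁₃ * x₀ * x₂
                   + q₂₂ * x₁ * x₁ + q₂₃ * x₁ * x₂ + q₃₃ * x₂ * x₂
    in v (+ 0) (+ 1) (+ 0) ≡ q₂₂
  coefficient₂₂ = solve-∀
  coefficient₂₃ : ∀ q₁₁ q₁₂ q₁₃ q₂₂ q₂₃ q₃₃ →
    let v : ℤ → ℤ → ℤ → ℤ
        v x₀ x₁ x₂ = q₁₁ * x₀ * x₀ + q₁₂ * x₀ * x₁ + q₁₃ * x₀ * x₂
                   + q₂₂ * x₁ * x₁ + q₂₃ * x₁ * x₂ + q₃₃ * x₂ * x₂
    in v (+ 0) (+ 1) (+ 1) - v (+ 0) (+ 1) (+ 0) - v (+ 0) (+ 0) (+ 1) ≡ q₂₃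
  coefficient₂₃ = solve-∀
  coefficient₃₃ : ∀ q₁₁ q₁₂ q₁₃ q₂₂ q₂₃ q₃₃ →
    let v : ℤ → ℤ → ℤ → ℤ
        v x₀ x₁ x₂ = q₁₁ * x₀ * x₀ + q₁₂ * x₀ * x₁ + q₁₃ * x₀ * x₂
                   + q₂₂ * x₁ * x₁ + q₂₃ * x₁ * x₂ + q₃₃ * x₂ * x₂
    in v (+ 0) (+ 0) (+ 1) ≡ q₃₃
  coefficient₃₃ = solve-∀

evalForm-injective : ∀ {q r} → (∀ x → evalForm q x ≡ evalForm r x) → q ≡ r
evalForm-injective {q} {r} q≗r = begin
  q                     ≡⟨ sym (polarize-evalForm q) ⟩
  polarize (evalForm q) ≡⟨ polarize-cong q≗r ⟩
  polarize (evalForm r) ≡⟨ polarize-evalForm r ⟩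
  r                     ∎
  where open ≡-Reasoning

pullbackJ : Mat3 → TernaryForm
pullbackJ B = form (diagonal i₀) (offDiagonal i₀ i₁) (offDiagonal i₀ i₂)
                   (diagonal i₁) (offDiagonal i₁ i₂) (diagonal i₂)
  where
  diagonal : Fin 3 → ℤ
  diagonal i = B i₀ i * B i₂ i - B i₁ i * B i₁ i
  offDiagonal : Fin 3 → Fin 3 → ℤ
  offDiagonal i j = B i₀ i * B i₂ j + B i₀ j * B i₂ i - + 2 * (B i₁ i * B i₁ j)

evalForm-pullbackJ : ∀ B x → evalForm (pullbackJ B) x ≡ J (B ·ᵥ x)
evalForm-pullbackJ B x = identity (B i₀ i₀) (B i₀ i₁) (B i₀ i₂) (B i₁ i₀) (B i₁ i₁) (B i₁ i₂)
                                  (B i₂ i₀) (B i₂ i₁) (B i₂ i₂) (x i₀) (x i₁) (x i₂)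
  where
  identity : ∀ a₀ a₁ a₂ b₀ b₁ b₂ c₀ c₁ c₂ x₀ x₁ x₂ →
    let h : ℤ → ℤ → ℤ → ℤ
        h a c b = a * c - b * b
        o : ℤ → ℤ → ℤ → ℤ → ℤ → ℤ → ℤ
        o aᵢ aⱼ cᵢ cⱼ bᵢ bⱼ = aᵢ * cⱼ + aⱼ * cᵢ - + 2 * (bᵢ * bⱼ)
        l : ℤ → ℤ → ℤ → ℤ
        l u₀ u₁ u₂ = u₀ * x₀ + u₁ * x₁ + u₂ * x₂
    in h a₀ c₀ b₀ * x₀ * x₀ + o a₀ a₁ c₀ c₁ b₀ b₁ * x₀ * x₁ + o a₀ a₂ c₀ c₂ b₀ b₂ * x₀ * x₂
       + h a₁ c₁ b₁ * x₁ * x₁ + o a₁ a₂ c₁ c₂ b₁ b₂ * x₁ * x₂ + h a₂ c₂ b₂ * x₂ * x₂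
       ≡ l a₀ a₁ a₂ * l c₀ c₁ c₂ - l b₀ b₁ b₂ * l b₀ b₁ b₂
  identity = solve-∀

normSqF-pullbackJ : ∀ B → let g = gram B in
  normSqF (pullbackJ B)
    ≡ + 2 * (g i₀ i₀ * g i₂ i₂) + + 2 * (g i₀ i₂ * g i₀ i₂) - + 8 * (g i₀ i₁ * g i₁ i₂) + + 4 * (g i₁ i₁ * g i₁ i₁)
normSqF-pullbackJ B = identity (B i₀ i₀) (B i₀ i₁) (B i₀ i₂) (B i₁ i₀) (B i₁ i₁) (B i₁ i₂)
                               (B i₂ i₀) (B i₂ i₁) (B i₂ i₂)
  where
  identity : ∀ a₀ a₁ a₂ b₀ b₁ b₂ c₀ c₁ c₂ →
    let d : ℤ → ℤ → ℤ → ℤ → ℤ → ℤ → ℤ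
        d u₀ u₁ u₂ v₀ v₁ v₂ = u₀ * v₀ + u₁ * v₁ + u₂ * v₂
        o : ℤ → ℤ → ℤ → ℤ → ℤ → ℤ → ℤ
        o aᵢ aⱼ cᵢ cⱼ bᵢ bⱼ = aᵢ * cⱼ + aⱼ * cᵢ - + 2 * (bᵢ * bⱼ)
        Q₀₀ = + 2 * (a₀ * c₀ - b₀ * b₀)
        Q₁₁ = + 2 * (a₁ * c₁ - b₁ * b₁)
        Q₂₂ = + 2 * (a₂ * c₂ - b₂ * b₂)
        Q₀₁ = o a₀ a₁ c₀ c₁ b₀ b₁
        Q₀₂ = o a₀ a₂ c₀ c₂ b₀ b₂
        Q₁₂ = o a₁ a₂ c₁ c₂ b₁ b₂
        α = d a₀ a₁ a₂ a₀ a₁ a₂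
        β = d b₀ b₁ b₂ b₀ b₁ b₂
        γ = d c₀ c₁ c₂ c₀ c₁ c₂
        δ = d a₀ a₁ a₂ b₀ b₁ b₂
        ε = d b₀ b₁ b₂ c₀ c₁ c₂
        ζ = d a₀ a₁ a₂ c₀ c₁ c₂
    in d Q₀₀ Q₀₁ Q₀₂ Q₀₀ Q₀₁ Q₀₂ + d Q₀₁ Q₁₁ Q₁₂ Q₀₁ Q₁₁ Q₁₂ + d Q₀₂ Q₁₂ Q₂₂ Q₀₂ Q₁₂ Q₂₂
       ≡ + 2 * (α * γ) + + 2 * (ζ * ζ) - + 8 * (δ * ε) + + 4 * (β * β)
  identity = solve-∀

dot-product-bound : ∀ a b c → + 8 * (dot a b * dot b c) ≤ dot a a * dot c c + + 16 * (dot b b * dot b b)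
dot-product-bound a b c = ≤-by-difference (normSqM t)
  (identity (a i₀) (a i₁) (a i₂) (b i₀) (b i₁) (b i₂) (c i₀) (c i₁) (c i₂)) (0≤-normSqM t)
  where
  t : Mat3
  t i j = a i * c j - + 4 * (b i * b j)
  identity : ∀ a₀ a₁ a₂ b₀ b₁ b₂ c₀ c₁ c₂ →
    let d : ℤ → ℤ → ℤ → ℤ → ℤ → ℤ → ℤ
        d u₀ u₁ u₂ v₀ v₁ v₂ = u₀ * v₀ + u₁ * v₁ + u₂ * v₂
        t : ℤ → ℤ → ℤ → ℤ → ℤ
        t aᵢ cⱼ bᵢ bⱼ = aᵢ * cⱼ - + 4 * (bᵢ * bⱼ)
        n : ℤ → ℤ → ℤ
        n aᵢ bᵢ = d (t aᵢ c₀ bᵢ b₀) (t aᵢ c₁ bᵢ b₁) (t aᵢ c₂ bᵢ b₂)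
                    (t aᵢ c₀ bᵢ b₀) (t aᵢ c₁ bᵢ b₁) (t aᵢ c₂ bᵢ b₂)
    in d a₀ a₁ a₂ a₀ a₁ a₂ * d c₀ c₁ c₂ c₀ c₁ c₂ + + 16 * (d b₀ b₁ b₂ b₀ b₁ b₂ * d b₀ b₁ b₂ b₀ b₁ b₂)
       ≡ + 8 * (d a₀ a₁ a₂ b₀ b₁ b₂ * d b₀ b₁ b₂ c₀ c₁ c₂) + (n a₀ b₀ + n a₁ b₁ + n a₂ b₂)
  identity = solve-∀

reduced-gram-bounds : ∀ {α β γ δ ε ζ} →
  0ℤ ≤ shift (+ 1) α δ → 0ℤ ≤ shift (- + 1) α δ → 0ℤ ≤ shift (+ 1) γ ε → 0ℤ ≤ shift (- + 1) γ ε →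
  + 8 * (δ * ε) ≤ α * γ + + 16 * (β * β) →
  let N = + 2 * (α * γ) + + 2 * (ζ * ζ) - + 8 * (δ * ε) + + 4 * (β * β)
  in α * γ ≤ + 4 * N × + 4 * (β * β) ≤ N
reduced-gram-bounds {α} {β} {γ} {δ} {ε} {ζ} 0≤α+2δ 0≤α-2δ 0≤γ+2ε 0≤γ-2ε 8δε≤αγ+16β² =
  ≤-by-difference (+ 3 * (X + Y) + S + + 8 * (ζ * ζ)) (identity₄ α β γ δ ε ζ)
    (0≤-+ (0≤-+ (0≤-scale 3 (0≤-+ 0≤X 0≤Y)) (i≤j⇒0≤j-i 8δε≤αγ+16β²)) (0≤-scale 8 (0≤-square ζ))) ,
  ≤-by-difference (X + Y + + 2 * (ζ * ζ)) (identity₁ α β γ δ ε ζ)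
    (0≤-+ (0≤-+ 0≤X 0≤Y) (0≤-scale 2 (0≤-square ζ)))
  where
  X Y S : ℤ
  X = shift (- + 1) α δ * shift (+ 1) γ ε
  Y = shift (+ 1) α δ * shift (- + 1) γ ε
  S = α * γ + + 16 * (β * β) - + 8 * (δ * ε)
  0≤X : 0ℤ ≤ X
  0≤X = 0≤-* 0≤α-2δ 0≤γ+2ε
  0≤Y : 0ℤ ≤ Y
  0≤Y = 0≤-* 0≤α+2δ 0≤γ-2ε
  identity₄ : ∀ α β γ δ ε ζ →
    let Δ : ℤ → ℤ → ℤ → ℤ
        Δ k x y = k * k * x + + 2 * k * y
        X = Δ (- + 1) α δ * Δ (+ 1) γ ε
        Y = Δ (+ 1) α δ * Δ (- + 1) γ ε
        N = + 2 * (α * γ) + + 2 * (ζ * ζ) - + 8 * (δ * ε) + + 4 * (β * β)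
    in + 4 * N ≡ α * γ + (+ 3 * (X + Y) + (α * γ + + 16 * (β * β) - + 8 * (δ * ε)) + + 8 * (ζ * ζ))
  identity₄ = solve-∀
  identity₁ : ∀ α β γ δ ε ζ →
    let Δ : ℤ → ℤ → ℤ → ℤ
        Δ k x y = k * k * x + + 2 * k * y
        X = Δ (- + 1) α δ * Δ (+ 1) γ ε
        Y = Δ (+ 1) α δ * Δ (- + 1) γ ε
        N = + 2 * (α * γ) + + 2 * (ζ * ζ) - + 8 * (δ * ε) + + 4 * (β * β)
    in N ≡ + 4 * (β * β) + (X + Y + + 2 * (ζ * ζ))
  identity₁ = solve-∀

reduced-form-bounds : ∀ q B → (∀ x → evalForm q x ≡ J (B ·ᵥ x)) → Reduced B →
  gram B i₀ i₀ * gram B i₂ i₂ ≤ + 4 * normSqF q × + 4 * (gram B i₁ i₁ * gram B i₁ i₁) ≤ normSqF q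
reduced-form-bounds q B q≗J∘B reduced =
  subst (λ N → g i₀ i₀ * g i₂ i₂ ≤ + 4 * N × + 4 * (g i₁ i₁ * g i₁ i₁) ≤ N) (sym normSqF-gram)
    (reduced-gram-bounds {g i₀ i₀} {g i₁ i₁} {g i₂ i₂} {g i₀ i₁} {g i₁ i₂} {g i₀ i₂}
      (0≤-difference _ (gram-lower (+ 1) B) lower⁺) (0≤-difference _ (gram-lower (- + 1) B) lower⁻)
      (0≤-difference _ (gram-upper (+ 1) B) upper⁺) (0≤-difference _ (gram-upper (- + 1) B) upper⁻)
      (dot-product-bound (B i₀) (B i₁) (B i₂)))
  where
  open Reduced reduced
  g : Fin 3 → Fin 3 → ℤ
  g = gram B
  normSqF-gram : normSqF q
    ≡ + 2 * (g i₀ i₀ * g i₂ i₂) + + 2 * (g i₀ i₂ * g i₀ i₂) - + 8 * (g i₀ i₁ * g i₁ i₂) + + 4 * (g i₁ i₁ * g i₁ i₁)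
  q≡pullbackJ : q ≡ pullbackJ B
  q≡pullbackJ = evalForm-injective {q} {pullbackJ B} (λ x → trans (q≗J∘B x) (sym (evalForm-pullbackJ B x)))
  normSqF-gram = trans (cong normSqF q≡pullbackJ) (normSqF-pullbackJ B)

theorem4 : (A : Mat3) (q : TernaryForm)
    → (∀ (x : Vec3) → evalForm q x ≡ J (A ·ᵥ x))
    → Σ Mat3 (λ U → IsAutJ U
        × (normSqV ((U ·ₘ A) i₀) * normSqV ((U ·ₘ A) i₂) ≤ + 81 * normSqF q)
        × (normSqV ((U ·ₘ A) i₁) * normSqV ((U ·ₘ A) i₁) ≤ + 100 * normSqF q))
theorem4 A q q≗J∘A with reduction A
... | U , autU , reduced = U , autU , ac≤81N , b²≤100N
  where
  q≗J∘UA : ∀ x → evalForm q x ≡ J ((U ·ₘ A) ·ᵥ x)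
  q≗J∘UA x = trans (q≗J∘A x) (sym (trans (J-cong (·ᵥ-assoc U A x)) (autU (A ·ᵥ x))))
  open ≤-Reasoning
  N β : ℤ
  N = normSqF q
  β = gram (U ·ₘ A) i₁ i₁
  0≤N : 0ℤ ≤ N
  0≤N = 0≤-normSqM (Qmat q)
  bounds : gram (U ·ₘ A) i₀ i₀ * gram (U ·ₘ A) i₂ i₂ ≤ + 4 * N × + 4 * (β * β) ≤ N
  bounds = reduced-form-bounds q (U ·ₘ A) q≗J∘UA reduced
  ac≤81N : gram (U ·ₘ A) i₀ i₀ * gram (U ·ₘ A) i₂ i₂ ≤ + 81 * N
  ac≤81N = ≤-trans (proj₁ bounds) (≤-scale (m≤m+n 4 77) 0≤N)
  b²≤100N : β * β ≤ + 100 * N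
  b²≤100N = begin
    β * β          ≡⟨ sym (*-identityˡ (β * β)) ⟩
    + 1 * (β * β)  ≤⟨ ≤-scale (m≤m+n 1 3) (0≤-square β) ⟩
    + 4 * (β * β)  ≤⟨ proj₂ bounds ⟩
    N              ≡⟨ sym (*-identityˡ N) ⟩
    + 1 * N        ≤⟨ ≤-scale (m≤m+n 1 99) 0≤N ⟩
    + 100 * N      ∎
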